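{- For all integers $n\geq 1$, $\overline{C}_{3,1}(n)\equiv 2\pmod 4$ if $n=k^2$ or $n=3k^2$ for some positive integer $k$, and $\overline{C}_{3,1}(n)\equiv 0\pmod 4$ otherwise.
   Context: An overpartition of $n$ is a partition of $n$ in which the first occurrence of each distinct part may optionally be overlined. $\overline{C}_{3,1}(n)$ denotes the number of overpartitions of $n$ in which no part is divisible by $3$ and only parts congruent to $\pm 1 \pmod{3}$ may be overlined; equivalently $\sum_{n\ge0}\overline{C}_{3,1}(n)q^n=\frac{(q^3;q^3)_\infty(-q;q^3)_\infty(-q^2;q^3)_\infty}{(q;q)_\infty}$, where $(A;q)_\infty=\prod_{j\ge0}(1-Aq^j)$. -}

module Defs where

open import Data.Nat using (ℕ; zero; suc; _+_; _*_; _∸_; _≤_)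
open import Data.Nat.DivMod using (_%_)
open import Data.Bool using (Bool; true; false; if_then_else_)
open import Data.Nat using (_≡ᵇ_; _≤ᵇ_)

-- Overpartitions of n whose parts all lie in {1, …, m}, none divisible by 3,
-- where the first occurrence of each distinct part may be overlined
-- (every allowed part is ≡ ±1 (mod 3), so every part may be overlined).
--
-- opCount m n counts them by choosing, for the largest allowed part size m,
-- its multiplicity j ≥ 0; if j ≥ 1 the first occurrence is overlined or not
-- (factor 2).

multSum : ℕ → (ℕ → ℕ) → ℕ → ℕ → ℕ
multSum p c n zero = 0
multSum p c n (suc k) =
  multSum p c n k + (if (suc k * p) ≤ᵇ n then c (n ∸ suc k * p) else 0)

opCount : ℕ → ℕ → ℕ
opCount zero n = if n ≡ᵇ 0 then 1 else 0
opCount (suc m) n =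
  if (suc m % 3) ≡ᵇ 0
  then opCount m n
  else opCount m n + 2 * multSum (suc m) (opCount m) n n

-- C̄_{3,1}(n): all parts are ≤ n, so take m = n.
Cbar31 : ℕ → ℕ
Cbar31 n = opCount n n

module Submission where

-- C̄₃,₁(n) mod 4 is governed by the parity of a divisor count.
--
-- (1) In the generating function ∏_{3 ∤ p} (1 + 2 Σ_{j ≥ 1} q^{jp}) every product
--     of two non-constant terms carries the factor 4, so modulo 4 it equals
--     1 + 2 Σ_{3 ∤ p} Σ_{j ≥ 1} q^{jp}.  On the level of the recursion opCount
--     this is  opCount m n ≡ δ n + 2 · G m n (mod 4), where G m n counts the
--     factorisations n = j · p with 3 ∤ p ≤ m (opCount-mod4).  Hence
--     C̄(n) ≡ 2 · G n n (mod 4) for n > 0, and only G n n mod 2 matters.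
-- (2) Splitting all factorisations n = j · p according to 3 ∣ p gives
--     #{n = j·p} = G n n + #{n = 3·j·p} (divisorPairs-split).  Both counts are
--     sums of a symmetric weight over a square, which is congruent mod 2 to the
--     diagonal sum: #{d : d² = n} and #{d : 3d² = n} (square-symmetric).
-- (3) Each diagonal count is 0 or 1 since squaring is injective, and 3k² is
--     never a positive square (no-square-thrice).  So their sum is 1 exactly
--     when n = k² or n = 3k², and 0 otherwise, which gives the theorem.

open import Defs
open import Data.Nat
open import Data.Nat.Properties
open import Data.Nat.DivMod
open import Data.Nat.Divisibility using (divides)
open import Data.Nat.Primality using (Prime; prime?; euclidsLemma)
open import Data.Bool using (Bool; true; false; if_then_else_; T)
open import Data.Unit using (tt)
open import Data.Empty using (⊥-elim)
open import Data.Product using (∃-syntax; _×_; _,_; proj₁; proj₂)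
open import Data.Sum using (_⊎_; inj₁; inj₂; reduce)
open import Function using (_∘_)
open import Function.Definitions using (Injective)
open import Relation.Binary using (tri<; tri≈; tri>)
open import Relation.Binary.PropositionalEquality
open import Relation.Nullary using (¬_; yes; no; contradiction)
open import Relation.Nullary.Decidable using (from-yes)
open import Data.Nat.Tactic.RingSolver using (solve-∀)

open ≡-Reasoning

+-even-mod2 : ∀ a g → (a + 2 * g) % 2 ≡ a % 2
+-even-mod2 a g = trans (cong (λ u → (a + u) % 2) (*-comm 2 g)) ([m+kn]%n≡m%n a g 2)

+-cong-mod : ∀ d .{{_ : NonZero d}} a b c e →
             a % d ≡ b % d → c % d ≡ e % d → (a + c) % d ≡ (b + e) % d
+-cong-mod d a b c e p q = begin
  (a + c) % d          ≡⟨ %-distribˡ-+ a c d ⟩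
  (a % d + c % d) % d  ≡⟨ cong₂ (λ u v → (u + v) % d) p q ⟩
  (b % d + e % d) % d  ≡⟨ %-distribˡ-+ b e d ⟨
  (b + e) % d          ∎

mod4⇒mod2 : ∀ a b → a % 4 ≡ b % 4 → a % 2 ≡ b % 2
mod4⇒mod2 a b p = begin
  a % 2      ≡⟨ m∣n⇒o%n%m≡o%m 2 4 a (divides 2 refl) ⟨
  a % 4 % 2  ≡⟨ cong (_% 2) p ⟩
  b % 4 % 2  ≡⟨ m∣n⇒o%n%m≡o%m 2 4 b (divides 2 refl) ⟩
  b % 2      ∎

double-mod4 : ∀ a b → a % 2 ≡ b % 2 → (2 * a) % 4 ≡ (2 * b) % 4
double-mod4 a b p = begin
  (2 * a) % 4  ≡⟨ cong (_% 4) (*-comm 2 a) ⟩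
  (a * 2) % 4  ≡⟨ m%n*o≡m*o%[n*o] a 2 2 ⟨
  a % 2 * 2    ≡⟨ cong (_* 2) p ⟩
  b % 2 * 2    ≡⟨ m%n*o≡m*o%[n*o] b 2 2 ⟩
  (b * 2) % 4  ≡⟨ cong (_% 4) (*-comm b 2) ⟩
  (2 * b) % 4  ∎

-- From g + (2t′ + r′) = 2t + r (a count split into two parts, each known up to an
-- even number) the parity of the first part is that of r + r′.
parity-of-difference : ∀ g t r t′ r′ → g + (2 * t′ + r′) ≡ 2 * t + r → g % 2 ≡ (r + r′) % 2
parity-of-difference g t r t′ r′ split = begin
  g % 2                    ≡⟨ +-even-mod2 g (t′ + r′) ⟨
  (g + 2 * (t′ + r′)) % 2  ≡⟨ cong (_% 2) (regroup g t′ r′) ⟩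
  (g + (2 * t′ + r′) + r′) % 2  ≡⟨ cong (λ u → (u + r′) % 2) split ⟩
  (2 * t + r + r′) % 2     ≡⟨ cong (_% 2) (reorder t r r′) ⟩
  (r + r′ + 2 * t) % 2     ≡⟨ +-even-mod2 (r + r′) t ⟩
  (r + r′) % 2             ∎
  where
  regroup : ∀ g t′ r′ → g + 2 * (t′ + r′) ≡ g + (2 * t′ + r′) + r′
  regroup = solve-∀
  reorder : ∀ t r r′ → 2 * t + r + r′ ≡ r + r′ + 2 * t
  reorder = solve-∀

𝟙[_≡_] : ℕ → ℕ → ℕ
𝟙[ a ≡ b ] = if a ≡ᵇ b then 1 else 0

𝟙-≡ : ∀ {a b} → a ≡ b → 𝟙[ a ≡ b ] ≡ 1
𝟙-≡ {a} {b} a≡b with a ≡ᵇ b in eq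
... | true  = refl
... | false with () ← subst T eq (≡⇒≡ᵇ a b a≡b)

𝟙-≢ : ∀ {a b} → a ≢ b → 𝟙[ a ≡ b ] ≡ 0
𝟙-≢ {a} {b} a≢b with a ≡ᵇ b in eq
... | true  = ⊥-elim (a≢b (≡ᵇ⇒≡ a b (subst T (sym eq) tt)))
... | false = refl

∑< : ℕ → (ℕ → ℕ) → ℕ
∑< zero    f = 0
∑< (suc N) f = ∑< N f + f N

∑-cong : ∀ {f g : ℕ → ℕ} N → (∀ i → i < N → f i ≡ g i) → ∑< N f ≡ ∑< N g
∑-cong zero    h = refl
∑-cong (suc N) h = cong₂ _+_ (∑-cong N (λ i i<N → h i (m<n⇒m<1+n i<N))) (h N ≤-refl)

∑-+ : ∀ (f g : ℕ → ℕ) N → ∑< N (λ i → f i + g i) ≡ ∑< N f + ∑< N g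
∑-+ f g zero    = refl
∑-+ f g (suc N) = trans (cong (_+ (f N + g N)) (∑-+ f g N)) (interchange (∑< N f) (∑< N g) (f N) (g N))
  where
  interchange : ∀ a b c d → a + b + (c + d) ≡ a + c + (b + d)
  interchange = solve-∀

∑-zero : ∀ {f : ℕ → ℕ} N → (∀ i → i < N → f i ≡ 0) → ∑< N f ≡ 0
∑-zero zero    h = refl
∑-zero (suc N) h = cong₂ _+_ (∑-zero N (λ i i<N → h i (m<n⇒m<1+n i<N))) (h N ≤-refl)

∑-vanishing-tail : ∀ {f : ℕ → ℕ} N M → N ≤ M → (∀ i → N ≤ i → f i ≡ 0) → ∑< M f ≡ ∑< N f
∑-vanishing-tail N zero    z≤n h = refl
∑-vanishing-tail N (suc M) N≤1+M h with m≤n⇒m<n∨m≡n N≤1+M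
... | inj₁ N<1+M =
  trans (cong₂ _+_ (∑-vanishing-tail N M (s≤s⁻¹ N<1+M) h) (h M (s≤s⁻¹ N<1+M))) (+-identityʳ _)
... | inj₂ refl  = refl

∑-indicator : ∀ d K → d < K → ∑< K (λ i → 𝟙[ i ≡ d ]) ≡ 1
∑-indicator d (suc K) d<1+K with d ≟ K
... | yes refl = cong₂ _+_ (∑-zero d (λ i i<d → 𝟙-≢ (<⇒≢ i<d))) (𝟙-≡ {d} refl)
... | no  d≢K  = cong₂ _+_ (∑-indicator d K (≤∧≢⇒< (s≤s⁻¹ d<1+K) d≢K)) (𝟙-≢ (d≢K ∘ sym))

off3 : ℕ → ℕ → ℕ
off3 p x = if p % 3 ≡ᵇ 0 then 0 else x

on3 : ℕ → ℕ → ℕ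
on3 p x = if p % 3 ≡ᵇ 0 then x else 0

∑-split-mod3 : ∀ (f : ℕ → ℕ) N → ∑< N f ≡ ∑< N (λ p → off3 p (f p)) + ∑< N (λ p → on3 p (f p))
∑-split-mod3 f N = trans (∑-cong N (λ p _ → split (p % 3 ≡ᵇ 0) (f p))) (∑-+ _ _ N)
  where
  split : ∀ (b : Bool) x → x ≡ (if b then 0 else x) + (if b then x else 0)
  split true  x = refl
  split false x = sym (+-identityʳ x)

∑-multiples-of-3 : ∀ (h : ℕ → ℕ) M → ∑< (3 * M) (λ p → on3 p (h p)) ≡ ∑< M (λ p → h (3 * p))
∑-multiples-of-3 h zero    = refl
∑-multiples-of-3 h (suc M) = begin
  ∑< (3 * suc M) F
    ≡⟨ cong (λ N → ∑< N F) (*-suc 3 M) ⟩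
  ∑< (3 * M) F + F (3 * M) + F (1 + 3 * M) + F (2 + 3 * M)
    ≡⟨ cong₂ (λ u v → u + v + F (1 + 3 * M) + F (2 + 3 * M))
             (∑-multiples-of-3 h M) (on3-multiple (3 * M) (residue 0)) ⟩
  ∑< M (λ p → h (3 * p)) + h (3 * M) + F (1 + 3 * M) + F (2 + 3 * M)
    ≡⟨ cong₂ (λ u v → ∑< M (λ p → h (3 * p)) + h (3 * M) + u + v)
             (on3-other (1 + 3 * M) (residue 1)) (on3-other (2 + 3 * M) (residue 2)) ⟩
  ∑< M (λ p → h (3 * p)) + h (3 * M) + 0 + 0
    ≡⟨ trans (+-identityʳ _) (+-identityʳ _) ⟩
  ∑< M (λ p → h (3 * p)) + h (3 * M) ∎
  where
  F : ℕ → ℕ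
  F p = on3 p (h p)
  residue : ∀ r → (r + 3 * M) % 3 ≡ r % 3
  residue r = trans (cong (λ u → (r + u) % 3) (*-comm 3 M)) ([m+kn]%n≡m%n r M 3)
  on3-multiple : ∀ p → p % 3 ≡ 0 → F p ≡ h p
  on3-multiple p e rewrite e = refl
  on3-other : ∀ p {r} → p % 3 ≡ suc r → F p ≡ 0
  on3-other p e rewrite e = refl

square : (ℕ → ℕ → ℕ) → ℕ → ℕ
square g N = ∑< N (λ p → ∑< N (g p))

triangle : (ℕ → ℕ → ℕ) → ℕ → ℕ
triangle g N = ∑< N (λ p → ∑< p (g p))

diagonal : (ℕ → ℕ → ℕ) → ℕ → ℕ
diagonal g N = ∑< N (λ d → g d d)

square-step : ∀ g N → square g (suc N) ≡ square g N + ∑< N (λ p → g p N) + ∑< N (g N) + g N N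
square-step g N = begin
  ∑< N (λ p → ∑< N (g p) + g p N) + (∑< N (g N) + g N N)
    ≡⟨ cong (_+ (∑< N (g N) + g N N)) (∑-+ (λ p → ∑< N (g p)) (λ p → g p N) N) ⟩
  square g N + ∑< N (λ p → g p N) + (∑< N (g N) + g N N)
    ≡⟨ +-assoc (square g N + ∑< N (λ p → g p N)) _ _ ⟨
  square g N + ∑< N (λ p → g p N) + ∑< N (g N) + g N N ∎

square-symmetric : ∀ g → (∀ p j → g p j ≡ g j p) → ∀ N → square g N ≡ 2 * triangle g N + diagonal g N
square-symmetric g g-sym zero    = refl
square-symmetric g g-sym (suc N) = begin
  square g (suc N)
    ≡⟨ square-step g N ⟩
  square g N + ∑< N (λ p → g p N) + ∑< N (g N) + g N N
    ≡⟨ cong (λ u → square g N + u + ∑< N (g N) + g N N) (∑-cong N (λ p _ → g-sym p N)) ⟩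
  square g N + ∑< N (g N) + ∑< N (g N) + g N N
    ≡⟨ cong (λ u → u + ∑< N (g N) + ∑< N (g N) + g N N) (square-symmetric g g-sym N) ⟩
  2 * triangle g N + diagonal g N + ∑< N (g N) + ∑< N (g N) + g N N
    ≡⟨ regroup (triangle g N) (diagonal g N) (∑< N (g N)) (g N N) ⟩
  2 * (triangle g N + ∑< N (g N)) + (diagonal g N + g N N) ∎
  where
  regroup : ∀ t d r x → 2 * t + d + r + r + x ≡ 2 * (t + r) + (d + x)
  regroup = solve-∀

-- δ n = [n = 0], the coefficients of the empty product
δ : ℕ → ℕ
δ n = 𝟙[ n ≡ 0 ]

-- G m n counts pairs (p, j) with 1 ≤ p ≤ m, 3 ∤ p, 1 ≤ j ≤ n and j · p = n; it
-- mirrors the recursion of opCount with every opCount replaced by δ.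
G : ℕ → ℕ → ℕ
G zero    n = 0
G (suc m) n = if suc m % 3 ≡ᵇ 0 then G m n else G m n + multSum (suc m) δ n n

multSum-cong-mod2 : ∀ p c c′ n k → (∀ x → c x % 2 ≡ c′ x % 2) →
                    multSum p c n k % 2 ≡ multSum p c′ n k % 2
multSum-cong-mod2 p c c′ n zero    h = refl
multSum-cong-mod2 p c c′ n (suc k) h with suc k * p ≤ᵇ n
... | true  = +-cong-mod 2 (multSum p c n k) (multSum p c′ n k) (c (n ∸ suc k * p)) (c′ (n ∸ suc k * p))
                           (multSum-cong-mod2 p c c′ n k h) (h _)
... | false = +-cong-mod 2 (multSum p c n k) (multSum p c′ n k) 0 0 (multSum-cong-mod2 p c c′ n k h) refl

-- Modulo 4 the overlined factors 1 + 2 Σ_{j ≥ 1} q^{jp} simply add up.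
opCount-mod4 : ∀ m n → opCount m n % 4 ≡ (δ n + 2 * G m n) % 4
opCount-mod4 zero    n = cong (_% 4) (sym (+-identityʳ (δ n)))
opCount-mod4 (suc m) n with suc m % 3 ≡ᵇ 0
... | true  = opCount-mod4 m n
... | false = begin
  (opCount m n + 2 * S) % 4           ≡⟨ +-cong-mod 4 (opCount m n) (δ n + 2 * G m n) (2 * S) (2 * S₀)
                                              (opCount-mod4 m n) (double-mod4 S S₀ S≡S₀) ⟩
  (δ n + 2 * G m n + 2 * S₀) % 4      ≡⟨ cong (_% 4) (regroup (δ n) (G m n) S₀) ⟩
  (δ n + 2 * (G m n + S₀)) % 4        ∎
  where
  S S₀ : ℕ
  S  = multSum (suc m) (opCount m) n n
  S₀ = multSum (suc m) δ n n
  -- the induction hypothesis read modulo 2: opCount m ≡ δ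
  opCount-mod2 : ∀ x → opCount m x % 2 ≡ δ x % 2
  opCount-mod2 x = trans (mod4⇒mod2 (opCount m x) (δ x + 2 * G m x) (opCount-mod4 m x))
                         (+-even-mod2 (δ x) (G m x))
  S≡S₀ : S % 2 ≡ S₀ % 2
  S≡S₀ = multSum-cong-mod2 (suc m) (opCount m) δ n n opCount-mod2
  regroup : ∀ a g s → a + 2 * g + 2 * s ≡ a + 2 * (g + s)
  regroup = solve-∀

cofactorCount : ℕ → ℕ → ℕ → ℕ
cofactorCount x p K = ∑< K (λ j → 𝟙[ j * p ≡ x ])

shifted-δ : ∀ a n → (if a ≤ᵇ n then δ (n ∸ a) else 0) ≡ 𝟙[ a ≡ n ]
shifted-δ zero          zero    = refl
shifted-δ zero          (suc n) = refl
shifted-δ (suc a)       zero    = refl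
shifted-δ (suc zero)    (suc n) = shifted-δ zero n
shifted-δ (suc (suc a)) (suc n) = shifted-δ (suc a) n

multSum-δ : ∀ p n k → multSum p δ (suc n) k ≡ cofactorCount (suc n) p (suc k)
multSum-δ p n zero    = refl
multSum-δ p n (suc k) = cong₂ _+_ (multSum-δ p n k) (shifted-δ (suc k * p) (suc n))

G-as-sum : ∀ m n → G m (suc n) ≡ ∑< (suc m) (λ p → off3 p (cofactorCount (suc n) p (suc (suc n))))
G-as-sum zero    n = refl
G-as-sum (suc m) n with suc m % 3 ≡ᵇ 0
... | true  = trans (G-as-sum m n) (sym (+-identityʳ _))
... | false = cong₂ _+_ (G-as-sum m n) (multSum-δ (suc m) n (suc n))

factor-bound : ∀ j p {x} → j * p ≡ x → 0 < x → j ≤ x × p ≤ x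
factor-bound j       zero    {x} e pos = contradiction (trans (sym (*-zeroʳ j)) e) (<⇒≢ pos)
factor-bound zero    (suc p)     e pos = contradiction e (<⇒≢ pos)
factor-bound (suc j) (suc p)     e pos =
  subst (suc j ≤_) e (m≤m*n (suc j) (suc p)) , subst (suc p ≤_) e (m≤n*m (suc p) (suc j))

cofactorCount-stable : ∀ x p K → 0 < x → x < K → cofactorCount x p K ≡ cofactorCount x p (suc x)
cofactorCount-stable x p K pos x<K = ∑-vanishing-tail (suc x) K x<K
  (λ j x<j → 𝟙-≢ (λ e → <⇒≱ x<j (proj₁ (factor-bound j p e pos))))

cofactorCount-large : ∀ x p K → 0 < x → x < p → cofactorCount x p K ≡ 0
cofactorCount-large x p K pos x<p = ∑-zero K
  (λ j _ → 𝟙-≢ (λ e → <⇒≱ x<p (proj₂ (factor-bound j p e pos))))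

-- A common range for both factors of n, divisible by 3.
bound : ℕ → ℕ
bound n = 3 * suc n

<-bound : ∀ n → n < bound n
<-bound n = m≤n*m (suc n) 3

G-as-double-sum : ∀ n → 0 < n → G n n ≡ ∑< (bound n) (λ p → off3 p (cofactorCount n p (bound n)))
G-as-double-sum n@(suc n′) pos = begin
  G n n
    ≡⟨ G-as-sum n n′ ⟩
  ∑< (suc n) (λ p → off3 p (cofactorCount n p (suc n)))
    ≡⟨ ∑-cong (suc n) (λ p _ → cong (off3 p) (sym (cofactorCount-stable n p K pos (<-bound n)))) ⟩
  ∑< (suc n) (λ p → off3 p (cofactorCount n p K))
    ≡⟨ ∑-vanishing-tail (suc n) K (<-bound n) large ⟨
  ∑< K (λ p → off3 p (cofactorCount n p K)) ∎
  where
  K = bound n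
  large : ∀ p → suc n ≤ p → off3 p (cofactorCount n p K) ≡ 0
  large p n<p rewrite cofactorCount-large n p K pos n<p with p % 3 ≡ᵇ 0
  ... | true  = refl
  ... | false = refl

factorPair : ℕ → ℕ → ℕ → ℕ
factorPair n p j = 𝟙[ j * p ≡ n ]

tripleFactorPair : ℕ → ℕ → ℕ → ℕ
tripleFactorPair n p j = 𝟙[ 3 * (j * p) ≡ n ]

factorPair-sym : ∀ n p j → factorPair n p j ≡ factorPair n j p
factorPair-sym n p j = cong 𝟙[_≡ n ] (*-comm j p)

tripleFactorPair-sym : ∀ n p j → tripleFactorPair n p j ≡ tripleFactorPair n j p
tripleFactorPair-sym n p j = cong (λ u → 𝟙[ 3 * u ≡ n ]) (*-comm j p)

-- Factorisations n = j · p with 3 ∣ p are the factorisations n = 3 · j · p′.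
divisorPairs-split : ∀ n → 0 < n →
  square (factorPair n) (bound n) ≡ G n n + square (tripleFactorPair n) (bound n)
divisorPairs-split n pos = begin
  square (factorPair n) K
    ≡⟨ ∑-split-mod3 (λ p → cofactorCount n p K) K ⟩
  ∑< K (λ p → off3 p (cofactorCount n p K)) + ∑< K (λ p → on3 p (cofactorCount n p K))
    ≡⟨ cong₂ _+_ (sym (G-as-double-sum n pos)) (∑-multiples-of-3 (λ p → cofactorCount n p K) (suc n)) ⟩
  G n n + ∑< (suc n) (λ p → cofactorCount n (3 * p) K)
    ≡⟨ cong (G n n +_) (∑-cong (suc n) (λ p _ → ∑-cong K (λ j _ → cong 𝟙[_≡ n ] (pull-3 j p)))) ⟩
  G n n + ∑< (suc n) (λ p → ∑< K (tripleFactorPair n p))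
    ≡⟨ cong (G n n +_) (∑-vanishing-tail (suc n) K (<-bound n) large) ⟨
  G n n + square (tripleFactorPair n) K ∎
  where
  K = bound n
  pull-3 : ∀ j p → j * (3 * p) ≡ 3 * (j * p)
  pull-3 = solve-∀
  large : ∀ p → suc n ≤ p → ∑< K (tripleFactorPair n p) ≡ 0
  large p n<p = ∑-zero K (λ j _ → 𝟙-≢ (λ e →
    <⇒≱ n<p (proj₂ (factor-bound (3 * j) p (trans (*-assoc 3 j p) e) pos))))

specialRoots : ℕ → ℕ
specialRoots n = diagonal (factorPair n) (bound n) + diagonal (tripleFactorPair n) (bound n)

-- G n n ≡ #{d² = n} + #{3d² = n} (mod 2), by comparing the diagonals of the split.
G-parity : ∀ n → 0 < n → G n n % 2 ≡ specialRoots n % 2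
G-parity n pos = parity-of-difference (G n n)
  (triangle (factorPair n) K) (diagonal (factorPair n) K)
  (triangle (tripleFactorPair n) K) (diagonal (tripleFactorPair n) K)
  (begin
    G n n + (2 * triangle (tripleFactorPair n) K + diagonal (tripleFactorPair n) K)
      ≡⟨ cong (G n n +_) (square-symmetric (tripleFactorPair n) (tripleFactorPair-sym n) K) ⟨
    G n n + square (tripleFactorPair n) K
      ≡⟨ divisorPairs-split n pos ⟨
    square (factorPair n) K
      ≡⟨ square-symmetric (factorPair n) (factorPair-sym n) K ⟩
    2 * triangle (factorPair n) K + diagonal (factorPair n) K ∎)
  where
  K = bound n

Cbar31-mod4 : ∀ n → 0 < n → Cbar31 n % 4 ≡ (2 * specialRoots n) % 4
Cbar31-mod4 n@(suc _) pos = trans (opCount-mod4 n n) (double-mod4 (G n n) (specialRoots n) (G-parity n pos))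

preimages : (ℕ → ℕ) → ℕ → ℕ → ℕ
preimages f x K = ∑< K (λ d → 𝟙[ f d ≡ x ])

preimages-unique : ∀ {f : ℕ → ℕ} {x d} K → Injective _≡_ _≡_ f → f d ≡ x → d < K → preimages f x K ≡ 1
preimages-unique {f} {x} {d} K f-inj fd≡x d<K = trans (∑-cong K same-indicator) (∑-indicator d K d<K)
  where
  same-indicator : ∀ i → i < K → 𝟙[ f i ≡ x ] ≡ 𝟙[ i ≡ d ]
  same-indicator i _ with i ≟ d
  ... | yes refl = trans (𝟙-≡ fd≡x) (sym (𝟙-≡ {i} refl))
  ... | no  i≢d  = trans (𝟙-≢ (λ fi≡x → i≢d (f-inj (trans fi≡x (sym fd≡x))))) (sym (𝟙-≢ i≢d))

preimages-none : ∀ {f : ℕ → ℕ} {x} K → (∀ d → f d ≢ x) → preimages f x K ≡ 0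
preimages-none K none = ∑-zero K (λ d _ → 𝟙-≢ (none d))

positive-root : ∀ (f : ℕ → ℕ) {d x} → f 0 ≡ 0 → 0 < x → f d ≡ x → 1 ≤ d
positive-root f {zero}  f0≡0 pos fd≡x = contradiction (trans (sym f0≡0) fd≡x) (<⇒≢ pos)
positive-root f {suc d} f0≡0 pos fd≡x = s≤s z≤n

square-injective : Injective _≡_ _≡_ (λ d → d * d)
square-injective {a} {b} e with <-cmp a b
... | tri< a<b _ _ = contradiction e (<⇒≢ (*-mono-< a<b a<b))
... | tri≈ _ a≡b _ = a≡b
... | tri> _ _ b<a = contradiction (sym e) (<⇒≢ (*-mono-< b<a b<a))

thrice-square-injective : Injective _≡_ _≡_ (λ d → 3 * (d * d))
thrice-square-injective {a} {b} e = square-injective (*-cancelˡ-≡ (a * a) (b * b) 3 e)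

root-below-bound : ∀ j d {n} → j * d ≡ n → 0 < n → d < bound n
root-below-bound j d e pos = ≤-<-trans (proj₂ (factor-bound j d e pos)) (<-bound _)

-- Irrationality of √3: a² = 3b² forces b = 0 (infinite descent, a = 3c gives b² = 3c²).
no-square-thrice : ∀ a b → a * a ≡ 3 * (b * b) → b ≡ 0
no-square-thrice a b = descent a a b ≤-refl
  where
  prime-3 : Prime 3
  prime-3 = from-yes (prime? 3)
  below-thrice : ∀ x → 0 < x → x < 3 * x
  below-thrice x pos = m<m+n x (≤-trans pos (m≤m+n x (1 * x)))
  b<a : ∀ a b → 0 < b → a * a ≡ 3 * (b * b) → b < a
  b<a a b pos e = ≰⇒> (λ a≤b → <⇒≱ (below-thrice (b * b) (*-mono-< pos pos))
                                     (subst (_≤ b * b) e (*-mono-≤ a≤b a≤b)))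
  thrice : ∀ c → c * 3 * (c * 3) ≡ 3 * (3 * (c * c))
  thrice = solve-∀
  descent : ∀ fuel a b → a ≤ fuel → a * a ≡ 3 * (b * b) → b ≡ 0
  descent fuel       a    zero    _     _ = refl
  descent zero       zero (suc b) _     ()
  descent (suc fuel) a    (suc b) a≤1+f e
    with divides c refl ← reduce (euclidsLemma a a prime-3 (divides (suc b * suc b) (trans e (*-comm 3 _))))
    with descent fuel (suc b) c (s≤s⁻¹ (≤-trans (b<a a (suc b) (s≤s z≤n) e) a≤1+f))
                 (*-cancelˡ-≡ (suc b * suc b) (3 * (c * c)) 3 (trans (sym e) (thrice c)))
  ... | refl = contradiction e λ ()

Special : ℕ → Set
Special n = ∃[ k ] (k ≥ 1 × (n ≡ k * k ⊎ n ≡ 3 * (k * k)))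

specialRoots-special : ∀ {n} → 0 < n → Special n → specialRoots n ≡ 1
specialRoots-special {n} pos (k , k≥1 , inj₁ n≡k²) =
  cong₂ _+_ (preimages-unique (bound n) square-injective (sym n≡k²) (root-below-bound k k (sym n≡k²) pos))
            (preimages-none (bound n) (λ d e → <⇒≢ (positive-root (λ d → 3 * (d * d)) refl pos e)
                                           (sym (no-square-thrice k d (trans (sym n≡k²) (sym e))))))
specialRoots-special {n} pos (k , k≥1 , inj₂ n≡3k²) =
  cong₂ _+_ (preimages-none (bound n) (λ d e → <⇒≢ k≥1 (sym (no-square-thrice d k (trans e n≡3k²)))))
            (preimages-unique (bound n) thrice-square-injective (sym n≡3k²)
              (root-below-bound (3 * k) k (trans (*-assoc 3 k k) (sym n≡3k²)) pos))

specialRoots-nonspecial : ∀ {n} → 0 < n → ¬ Special n → specialRoots n ≡ 0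
specialRoots-nonspecial {n} pos ¬special =
  cong₂ _+_
    (preimages-none (bound n) (λ d e → ¬special (d , positive-root (λ d → d * d) refl pos e , inj₁ (sym e))))
    (preimages-none (bound n) (λ d e → ¬special (d , positive-root (λ d → 3 * (d * d)) refl pos e , inj₂ (sym e))))

mainTheorem5 : (n : ℕ) → n ≥ 1 →
    ((∃[ k ] (k ≥ 1 × (n ≡ k * k ⊎ n ≡ 3 * (k * k)))) → Cbar31 n % 4 ≡ 2)
    × (¬ (∃[ k ] (k ≥ 1 × (n ≡ k * k ⊎ n ≡ 3 * (k * k)))) → Cbar31 n % 4 ≡ 0)
mainTheorem5 n n≥1 =
    (λ special  → trans (Cbar31-mod4 n n≥1) (cong (λ r → (2 * r) % 4) (specialRoots-special n≥1 special)))
  , (λ ¬special → trans (Cbar31-mod4 n n≥1) (cong (λ r → (2 * r) % 4) (specialRoots-nonspecial n≥1 ¬special)))
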